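{- For every positive integer $k$, there exist oriented graphs $\vec{G}$ with $\delta^*_{\rm out}(\vec{G})\le k$ that are not $(k+1)$-mixing.
   Context: An oriented graph is a digraph with no pair of opposite arcs $uv,vu$. The out-degeneracy $\delta^*_{\rm out}(D)=\max\{\delta^+(H): H \text{ subdigraph of } D\}$, where $\delta^+$ is minimum out-degree; a digraph is $k$-out-degenerate if its out-degeneracy is at most $k$. A $(k+1)$-dicolouring is a map $V\to\{1,\dots,k+1\}$ with no monochromatic directed cycle; a digraph is $(k+1)$-mixing if the graph on its $(k+1)$-dicolourings, two adjacent if they differ on exactly one vertex, is connected. -}

module Defs where

open import Data.Nat using (ℕ; zero; suc; _+_; _≤_)
open import Data.Bool using (Bool; true; false; if_then_else_)
open import Data.Fin using (Fin; zero; suc; inject₁; fromℕ)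
open import Data.Product using (Σ; ∃; _×_; _,_; proj₁)
open import Relation.Binary.PropositionalEquality using (_≡_; _≢_)
open import Relation.Nullary using (¬_)
open import Relation.Binary.Construct.Closure.ReflexiveTransitive using (Star)
open import Function.Definitions using (Injective)

Digraph : ℕ → Set
Digraph n = Fin n → Fin n → Bool

Arc : ∀ {n} → Digraph n → Fin n → Fin n → Set
Arc D u v = D u v ≡ true

-- Oriented: no pair of opposite arcs uv, vu (for u = v this also forbids loops).
Oriented : ∀ {n} → Digraph n → Set
Oriented {n} D = ∀ (u v : Fin n) → Arc D u v → ¬ Arc D v u

count : ∀ {n} → (Fin n → Bool) → ℕ
count {zero}  p = 0
count {suc n} p = (if p zero then 1 else 0) + count (λ i → p (suc i))

record Subdigraph {n : ℕ} (D : Digraph n) : Set where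
  field
    S      : Fin n → Bool
    B      : Fin n → Fin n → Bool
    B⊆D    : ∀ u v → B u v ≡ true → D u v ≡ true
    B⊆S×S  : ∀ u v → B u v ≡ true → (S u ≡ true) × (S v ≡ true)

open Subdigraph public

outdeg : ∀ {n} {D : Digraph n} → Subdigraph D → Fin n → ℕ
outdeg H v = count (λ w → B H v w)

OutDegenerate : ℕ → ∀ {n} → Digraph n → Set
OutDegenerate k D =
  ∀ (H : Subdigraph D) → (∃ λ v → S H v ≡ true) →
  ∃ λ v → (S H v ≡ true) × (outdeg H v ≤ k)

-- A directed cycle of length m+2 (m+2 distinct vertices f 0, …, f (m+1)
-- with arcs f i → f (i+1) and f (m+1) → f 0).
record DirectedCycle {n : ℕ} (D : Digraph n) : Set where
  field
    len    : ℕ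
    vtx    : Fin (suc (suc len)) → Fin n
    inj    : Injective _≡_ _≡_ vtx
    step   : ∀ (i : Fin (suc len)) → Arc D (vtx (inject₁ i)) (vtx (suc i))
    close  : Arc D (vtx (fromℕ (suc len))) (vtx zero)

open DirectedCycle public

IsDicolouring : ∀ {n} → Digraph n → (q : ℕ) → (Fin n → Fin q) → Set
IsDicolouring D q c =
  ∀ (C : DirectedCycle D) → ¬ (∀ i j → c (vtx C i) ≡ c (vtx C j))

Dicolouring : ∀ {n} → Digraph n → ℕ → Set
Dicolouring {n} D q = Σ (Fin n → Fin q) (IsDicolouring D q)

Adjacent : ∀ {n} {D : Digraph n} {q} → Dicolouring D q → Dicolouring D q → Set
Adjacent {n} (α , _) (β , _) =
  ∃ λ (v : Fin n) → (α v ≢ β v) × (∀ w → w ≢ v → α w ≡ β w)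

Mixing : ℕ → ∀ {n} → Digraph n → Set
Mixing q D = ∀ (α β : Dicolouring D q) → Star Adjacent α β

-- Take k + 1 classes of three vertices each, (c , 0) → (c , 1) → (c , 2) being a directed
-- path. Between classes c < d there is an arc (c , i) → (d , j) when the levels i, j are
-- neighbouring, and an arc (d , j) → (c , i) otherwise. Colouring every vertex by its class
-- is a dicolouring, and it is frozen: recolouring (c , i) with the colour of a class d closes
-- a directed triangle through two vertices of class d. Permuting the class colours gives a
-- different dicolouring, so the reconfiguration graph is disconnected. In any subdigraph H,
-- a vertex of level 2 in the least class containing one (or, if there is none, any vertex of
-- the highest level present in H) has at most one out-neighbour in each other class and none
-- in its own, hence out-degree at most k.
module Submission where

open import Defs
open import Data.Nat using (ℕ; zero; suc; _+_; _≤_; _<_; z≤n; s≤s)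
open import Data.Nat.Properties
  using (module ≤-Reasoning; ≤-refl; ≤-trans; ≤-reflexive; <⇒≤; <-irrefl; <-asym; ≤-<-trans;
         n≤1+n; +-suc; +-comm; +-identityʳ; +-mono-≤)
open import Data.Bool using (Bool; true; false; not; if_then_else_)
open import Data.Bool.Properties using (not-¬)
open import Data.Fin using (Fin; zero; suc; inject₁; fromℕ; _↑ˡ_; _↑ʳ_; splitAt)
open import Data.Fin.Properties using (_≟_; splitAt-↑ˡ; splitAt-↑ʳ; join-splitAt)
open import Data.Fin.Permutation using (Permutation′; transpose; _⟨$⟩ʳ_) renaming (id to idₚ)
open import Data.Product using (Σ; ∃; ∃₂; _×_; _,_; proj₁; proj₂)
open import Data.Sum using (_⊎_; inj₁; inj₂; [_,_])
open import Data.Empty using (⊥)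
open import Function using (_∘_)
open import Function.Bundles using (Injection)
open import Function.Definitions using (Injective)
open import Function.Properties.Inverse using (↔⇒↣)
open import Relation.Nullary using (¬_; yes; no; contradiction)
open import Relation.Binary.PropositionalEquality
  using (_≡_; _≢_; refl; sym; trans; cong; ≢-sym; cong₂; subst)
open import Relation.Binary.Construct.Closure.ReflexiveTransitive using (ε; _◅_)

module _ {n : ℕ} {D : Digraph n} where

  Oriented⇒loopless : Oriented D → ∀ u → ¬ Arc D u u
  Oriented⇒loopless oriented u uu = oriented u u uu uu

  triangle : (∀ u → ¬ Arc D u u) → ∀ {a b c} →
             Arc D a b → Arc D b c → Arc D c a → DirectedCycle D
  triangle loopless {a} {b} {c} ab bc ca = record
    { len = 1 ; vtx = corner ; inj = corner-injective
    ; step = λ { zero → ab ; (suc zero) → bc } ; close = ca }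
    where
      arc⇒≢ : ∀ {u v} → Arc D u v → u ≢ v
      arc⇒≢ uv refl = loopless _ uv

      corner : Fin 3 → Fin n
      corner zero             = a
      corner (suc zero)       = b
      corner (suc (suc zero)) = c

      corner-injective : Injective _≡_ _≡_ corner
      corner-injective {zero}             {zero}             _ = refl
      corner-injective {zero}             {suc zero}         e = contradiction e (arc⇒≢ ab)
      corner-injective {zero}             {suc (suc zero)}   e = contradiction (sym e) (arc⇒≢ ca)
      corner-injective {suc zero}         {zero}             e = contradiction (sym e) (arc⇒≢ ab)
      corner-injective {suc zero}         {suc zero}         _ = refl
      corner-injective {suc zero}         {suc (suc zero)}   e = contradiction e (arc⇒≢ bc)
      corner-injective {suc (suc zero)}   {zero}             e = contradiction e (arc⇒≢ ca)
      corner-injective {suc (suc zero)}   {suc zero}         e = contradiction (sym e) (arc⇒≢ bc)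
      corner-injective {suc (suc zero)}   {suc (suc zero)}   _ = refl

ascending⇒first≤last : ∀ m (h : Fin (suc m) → ℕ) →
                       (∀ i → h (inject₁ i) < h (suc i)) → h zero ≤ h (fromℕ m)
ascending⇒first≤last zero    h ascending = ≤-refl
ascending⇒first≤last (suc m) h ascending =
  ≤-trans (ascending⇒first≤last m (h ∘ inject₁) (ascending ∘ inject₁))
          (<⇒≤ (ascending (fromℕ m)))

module _ {n : ℕ} {D : Digraph n} {q : ℕ} where

  graded⇒dicolouring : (c : Fin n → Fin q) (h : Fin n → ℕ) →
                       (∀ u v → Arc D u v → c u ≡ c v → h u < h v) →
                       IsDicolouring D q c
  graded⇒dicolouring c h graded C monochromatic =
    <-irrefl refl (≤-<-trans (ascending⇒first≤last (suc (len C)) (h ∘ vtx C) ascending) closing)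
    where
      ascending : ∀ i → h (vtx C (inject₁ i)) < h (vtx C (suc i))
      ascending i = graded _ _ (step C i) (monochromatic _ _)
      closing : h (vtx C (fromℕ (suc (len C)))) < h (vtx C zero)
      closing = graded _ _ (close C) (monochromatic _ _)

  Frozen : Dicolouring D q → Set
  Frozen α = ∀ γ → ¬ Adjacent {D = D} α γ

  recolouringClosesCycle⇒frozen :
    (α : Dicolouring D q) →
    (∀ v x → x ≢ proj₁ α v →
       Σ (DirectedCycle D) λ C → ∀ i → vtx C i ≡ v ⊎ proj₁ α (vtx C i) ≡ x) →
    Frozen α
  recolouringClosesCycle⇒frozen (α , _) closesCycle (γ , γ-dicolouring) (v , α≢γ , agree)
    with closesCycle v (γ v) (≢-sym α≢γ)
  ... | C , on-C = γ-dicolouring C λ i j → trans (γ≡γv i) (sym (γ≡γv j))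
    where
      γ≡γv : ∀ i → γ (vtx C i) ≡ γ v
      γ≡γv i with on-C i | vtx C i ≟ v
      ... | inj₁ at-v | _       = cong γ at-v
      ... | inj₂ _    | yes e   = cong γ e
      ... | inj₂ α≡γv | no  w≢v = trans (sym (agree _ w≢v)) α≡γv

  frozen⇒¬mixing : (α β : Dicolouring D q) → Frozen α → proj₁ α ≢ proj₁ β → ¬ Mixing q D
  frozen⇒¬mixing α β frozen α≢β mixing with mixing α β
  ... | ε                = α≢β refl
  ... | _◅_ {j = γ} adj _ = frozen γ adj

count-++ : ∀ a b (p : Fin (a + b) → Bool) →
           count p ≡ count (λ i → p (i ↑ˡ b)) + count (λ i → p (a ↑ʳ i))
count-++ zero    b p = refl
count-++ (suc a) b p with p zero
... | true  = cong suc (count-++ a b (p ∘ suc))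
... | false = count-++ a b (p ∘ suc)

count-mono : ∀ {m} (p r : Fin m → Bool) → (∀ x → p x ≡ true → r x ≡ true) →
             count p ≤ count r
count-mono {zero}  p r p⊆r = z≤n
count-mono {suc m} p r p⊆r with p zero in p0 | r zero in r0
... | true  | true  = s≤s (count-mono (p ∘ suc) (r ∘ suc) (p⊆r ∘ suc))
... | true  | false with () ← trans (sym (p⊆r zero p0)) r0
... | false | true  = ≤-trans (count-mono (p ∘ suc) (r ∘ suc) (p⊆r ∘ suc)) (n≤1+n _)
... | false | false = count-mono (p ∘ suc) (r ∘ suc) (p⊆r ∘ suc)

count-none : ∀ {m} (p : Fin m → Bool) → (∀ x → p x ≢ true) → count p ≡ 0
count-none {zero}  p none = refl
count-none {suc m} p none with p zero in p0
... | true  = contradiction p0 (none zero)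
... | false = count-none (p ∘ suc) (none ∘ suc)

data Comparison : Set where
  LT EQ GT : Comparison

flip : Comparison → Comparison
flip LT = GT
flip EQ = EQ
flip GT = LT

isLT isGT : Comparison → Bool
isLT LT = true
isLT _  = false
isGT GT = true
isGT _  = false

compareFin : ∀ {m} → Fin m → Fin m → Comparison
compareFin zero    zero    = EQ
compareFin zero    (suc _) = LT
compareFin (suc _) zero    = GT
compareFin (suc a) (suc b) = compareFin a b

compareFin-flip : ∀ {m} (a b : Fin m) → compareFin b a ≡ flip (compareFin a b)
compareFin-flip zero    zero    = refl
compareFin-flip zero    (suc b) = refl
compareFin-flip (suc a) zero    = refl
compareFin-flip (suc a) (suc b) = compareFin-flip a b

compareFin-refl : ∀ {m} (a : Fin m) → compareFin a a ≡ EQ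
compareFin-refl zero    = refl
compareFin-refl (suc a) = compareFin-refl a

compareFin≡EQ⇒≡ : ∀ {m} (a b : Fin m) → compareFin a b ≡ EQ → a ≡ b
compareFin≡EQ⇒≡ zero    zero    _ = refl
compareFin≡EQ⇒≡ (suc a) (suc b) e = cong suc (compareFin≡EQ⇒≡ a b e)

count-isLT+count-isGT : ∀ k (c : Fin (suc k)) →
  count (isLT ∘ compareFin c) + count (isGT ∘ compareFin c) ≡ k
count-isLT+count-isGT k       zero    =
  trans (cong₂ _+_ (count-all k) (count-none {suc k} (isGT ∘ compareFin zero) none-below-zero))
        (+-identityʳ k)
  where
    count-all : ∀ m → count {m} (λ _ → true) ≡ m
    count-all zero    = refl
    count-all (suc m) = cong suc (count-all m)
    none-below-zero : ∀ d → isGT (compareFin zero d) ≢ true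
    none-below-zero zero    ()
    none-below-zero (suc _) ()
count-isLT+count-isGT (suc k) (suc c) =
  trans (+-suc (count (isLT ∘ compareFin c)) (count (isGT ∘ compareFin c)))
        (cong suc (count-isLT+count-isGT k c))

least-or-none : ∀ {m} (p : Fin m → Bool) →
  (∃ λ c → p c ≡ true × ∀ d → compareFin c d ≡ GT → p d ≡ false) ⊎ (∀ d → p d ≡ false)
least-or-none {zero}  p = inj₂ λ ()
least-or-none {suc m} p with p zero in p0
... | true  = inj₁ (zero , p0 , λ { (suc _) () })
... | false with least-or-none (p ∘ suc)
...   | inj₁ (c , pc , least) = inj₁ (suc c , pc , λ { zero _ → p0 ; (suc d) c>d → least d c>d })
...   | inj₂ none            = inj₂ λ { zero → p0 ; (suc d) → none d }

data Level : Set where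
  L0 L1 L2 : Level

height : Level → ℕ
height L0 = 0
height L1 = 1
height L2 = 2

neighbouring : Level → Level → Bool
neighbouring L0 L1 = true
neighbouring L1 L0 = true
neighbouring L1 L2 = true
neighbouring L2 L1 = true
neighbouring _  _  = false

successor : Level → Level → Bool
successor L0 L1 = true
successor L1 L2 = true
successor _  _  = false

neighbouring-comm : ∀ i j → neighbouring i j ≡ neighbouring j i
neighbouring-comm L0 L0 = refl
neighbouring-comm L0 L1 = refl
neighbouring-comm L0 L2 = refl
neighbouring-comm L1 L0 = refl
neighbouring-comm L1 L1 = refl
neighbouring-comm L1 L2 = refl
neighbouring-comm L2 L0 = refl
neighbouring-comm L2 L1 = refl
neighbouring-comm L2 L2 = refl

successor⇒height< : ∀ i j → successor i j ≡ true → height i < height j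
successor⇒height< L0 L1 _ = s≤s z≤n
successor⇒height< L1 L2 _ = s≤s (s≤s z≤n)

arcRule : Comparison → Level → Level → Bool
arcRule LT i j = neighbouring i j
arcRule EQ i j = successor i j
arcRule GT i j = not (neighbouring i j)

arcRule-antisym : ∀ x i j → arcRule x i j ≡ true → arcRule (flip x) j i ≡ true → ⊥
arcRule-antisym LT i j ij ji = not-¬ (trans (sym ij) (neighbouring-comm i j)) (sym ji)
arcRule-antisym GT i j ij ji = not-¬ (trans (sym ji) (neighbouring-comm j i)) (sym ij)
arcRule-antisym EQ i j ij ji = <-asym (successor⇒height< i j ij) (successor⇒height< j i ji)

crossing : Level → Level → Comparison
crossing i j = if neighbouring i j then LT else GT

arcRule⇒crossing : ∀ x i j → successor i j ≡ false → arcRule x i j ≡ true → x ≡ crossing i j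
arcRule⇒crossing LT i j _ ij rewrite ij = refl
arcRule⇒crossing GT i j _ ij with neighbouring i j
... | false = refl
arcRule⇒crossing EQ i j not-successor ij with () ← trans (sym ij) not-successor

closingLevels : ∀ x l → x ≢ EQ → ∃₂ λ s t →
  arcRule x l s ≡ true × arcRule EQ s t ≡ true × arcRule (flip x) t l ≡ true
closingLevels LT L0 _ = L1 , L2 , refl , refl , refl
closingLevels LT L1 _ = L0 , L1 , refl , refl , refl
closingLevels LT L2 _ = L1 , L2 , refl , refl , refl
closingLevels GT L0 _ = L0 , L1 , refl , refl , refl
closingLevels GT L1 _ = L1 , L2 , refl , refl , refl
closingLevels GT L2 _ = L0 , L1 , refl , refl , refl
closingLevels EQ _ EQ≢EQ = contradiction refl EQ≢EQ

module Construction (k : ℕ) where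

  m : ℕ
  m = suc k

  n : ℕ
  n = m + (m + m)

  vertex : Level → Fin m → Fin n
  vertex L0 c = c ↑ˡ (m + m)
  vertex L1 c = m ↑ʳ (c ↑ˡ m)
  vertex L2 c = m ↑ʳ (m ↑ʳ c)

  decode : Fin n → Level × Fin m
  decode w = [ (L0 ,_) , [ (L1 ,_) , (L2 ,_) ] ∘ splitAt m ] (splitAt m w)

  level : Fin n → Level
  level = proj₁ ∘ decode

  class : Fin n → Fin m
  class = proj₂ ∘ decode

  decode-vertex : ∀ l c → decode (vertex l c) ≡ (l , c)
  decode-vertex L0 c rewrite splitAt-↑ˡ m c (m + m) = refl
  decode-vertex L1 c rewrite splitAt-↑ʳ m (m + m) (c ↑ˡ m) | splitAt-↑ˡ m c m = refl
  decode-vertex L2 c rewrite splitAt-↑ʳ m (m + m) (m ↑ʳ c) | splitAt-↑ʳ m m c = refl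

  class-vertex : ∀ l c → class (vertex l c) ≡ c
  class-vertex l c = cong proj₂ (decode-vertex l c)

  vertex-surjective : ∀ w → ∃₂ λ l c → vertex l c ≡ w
  vertex-surjective w with splitAt m w | join-splitAt m (m + m) w
  ... | inj₁ c | c≡w = L0 , c , c≡w
  ... | inj₂ r | r≡w with splitAt m r | join-splitAt m m r
  ...   | inj₁ c | c≡r = L1 , c , trans (cong (m ↑ʳ_) c≡r) r≡w
  ...   | inj₂ c | c≡r = L2 , c , trans (cong (m ↑ʳ_) c≡r) r≡w

  G : Digraph n
  G u v = arcRule (compareFin (class u) (class v)) (level u) (level v)

  G-vertex : ∀ i c j d → G (vertex i c) (vertex j d) ≡ arcRule (compareFin c d) i j
  G-vertex i c j d rewrite decode-vertex i c | decode-vertex j d = refl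

  arcRule⇒Arc : ∀ i c j d → arcRule (compareFin c d) i j ≡ true → Arc G (vertex i c) (vertex j d)
  arcRule⇒Arc i c j d = trans (G-vertex i c j d)

  Arc⇒arcRule : ∀ i c j d → Arc G (vertex i c) (vertex j d) → arcRule (compareFin c d) i j ≡ true
  Arc⇒arcRule i c j d = trans (sym (G-vertex i c j d))

  oriented : Oriented G
  oriented u v uv vu rewrite compareFin-flip (class u) (class v) =
    arcRule-antisym (compareFin (class u) (class v)) (level u) (level v) uv vu

  byClass : Permutation′ m → Dicolouring G m
  byClass π = (π ⟨$⟩ʳ_) ∘ class , graded⇒dicolouring _ (height ∘ level) graded
    where
      graded : ∀ u v → Arc G u v → π ⟨$⟩ʳ class u ≡ π ⟨$⟩ʳ class v →
               height (level u) < height (level v)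
      graded u v uv same with Injection.injective (↔⇒↣ π) same
      ... | same-class rewrite same-class | compareFin-refl (class v) = successor⇒height< _ _ uv

  byClass-frozen : Frozen (byClass idₚ)
  byClass-frozen = recolouringClosesCycle⇒frozen (byClass idₚ) closesCycle
    where
      closesCycle : ∀ v x → x ≢ class v →
        Σ (DirectedCycle G) λ C → ∀ i → vtx C i ≡ v ⊎ class (vtx C i) ≡ x
      closesCycle v x x≢v with vertex-surjective v
      ... | l , c , refl with closingLevels (compareFin c x) l c≢x
        where
          c≢x : compareFin c x ≢ EQ
          c≢x c≡x = x≢v (trans (sym (compareFin≡EQ⇒≡ c x c≡x)) (sym (class-vertex l c)))
      ... | s , t , ls , st , tl = C , on-C
        where
          C : DirectedCycle G
          C = triangle (Oriented⇒loopless oriented) {vertex l c} {vertex s x} {vertex t x}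
                (arcRule⇒Arc l c s x ls)
                (arcRule⇒Arc s x t x (subst (λ y → arcRule y s t ≡ true) (sym (compareFin-refl x)) st))
                (arcRule⇒Arc t x l c (subst (λ y → arcRule y t l ≡ true) (sym (compareFin-flip c x)) tl))
          on-C : ∀ i → vtx C i ≡ vertex l c ⊎ class (vtx C i) ≡ x
          on-C zero             = inj₁ refl
          on-C (suc zero)       = inj₂ (class-vertex s x)
          on-C (suc (suc zero)) = inj₂ (class-vertex t x)

  above below : Fin m → Fin m → Bool
  above c = isLT ∘ compareFin c
  below c = isGT ∘ compareFin c

  count-below+count-above : ∀ c → count (below c) + count (above c) ≡ k
  count-below+count-above c = trans (+-comm (count (below c)) _) (count-isLT+count-isGT k c)

  module _ (H : Subdigraph G) where

    outdeg-levels : ∀ v → outdeg H v ≡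
      count (B H v ∘ vertex L0) + (count (B H v ∘ vertex L1) + count (B H v ∘ vertex L2))
    outdeg-levels v = trans (count-++ m (m + m) (B H v)) (cong (count (B H v ∘ vertex L0) +_)
                                                              (count-++ m m (B H v ∘ (m ↑ʳ_))))

    outdeg≤ : ∀ v (P₀ P₁ : Fin m → Bool) →
      (∀ d → B H v (vertex L0 d) ≡ true → P₀ d ≡ true) →
      (∀ d → B H v (vertex L1 d) ≡ true → P₁ d ≡ true) →
      (∀ d → B H v (vertex L2 d) ≢ true) →
      outdeg H v ≤ count P₀ + count P₁
    outdeg≤ v P₀ P₁ ⊆P₀ ⊆P₁ none₂ = begin
      outdeg H v                ≡⟨ outdeg-levels v ⟩
      n₀ + (n₁ + n₂)            ≡⟨ cong (λ z → n₀ + (n₁ + z)) (count-none _ none₂) ⟩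
      n₀ + (n₁ + 0)             ≡⟨ cong (n₀ +_) (+-identityʳ n₁) ⟩
      n₀ + n₁                   ≤⟨ +-mono-≤ (count-mono _ P₀ ⊆P₀) (count-mono _ P₁ ⊆P₁) ⟩
      count P₀ + count P₁       ∎
      where
        open ≤-Reasoning
        n₀ n₁ n₂ : ℕ
        n₀ = count (B H v ∘ vertex L0)
        n₁ = count (B H v ∘ vertex L1)
        n₂ = count (B H v ∘ vertex L2)

    crossingArc : ∀ i c j d → successor i j ≡ false →
                  B H (vertex i c) (vertex j d) ≡ true → compareFin c d ≡ crossing i j
    crossingArc i c j d not-successor e =
      arcRule⇒crossing _ i j not-successor (Arc⇒arcRule i c j d (B⊆D H _ _ e))

    absent : ∀ {u w} → S H w ≡ false → B H u w ≢ true
    absent w∉H e with () ← trans (sym (proj₂ (B⊆S×S H _ _ e))) w∉H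

  outDegenerate : OutDegenerate k G
  outDegenerate H (w , w∈H) with least-or-none (S H ∘ vertex L2)
  ... | inj₁ (c , c∈H , least) = vertex L2 c , c∈H ,
    ≤-trans (outdeg≤ H _ (below c) (above c)
                     (λ d e → cong isGT (crossingArc H L2 c L0 d refl e))
                     (λ d e → cong isLT (crossingArc H L2 c L1 d refl e))
                     (λ d e → absent H (least d (crossingArc H L2 c L2 d refl e)) e))
            (≤-reflexive (count-below+count-above c))
  ... | inj₂ none₂ with least-or-none (S H ∘ vertex L1)
  ...   | inj₁ (c , c∈H , _) = vertex L1 c , c∈H ,
    ≤-trans (outdeg≤ H _ (above c) (below c)
                     (λ d e → cong isLT (crossingArc H L1 c L0 d refl e))
                     (λ d e → cong isGT (crossingArc H L1 c L1 d refl e))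
                     (λ d → absent H (none₂ d)))
            (≤-reflexive (count-isLT+count-isGT k c))
  ...   | inj₂ none₁ with least-or-none (S H ∘ vertex L0)
  ...     | inj₁ (c , c∈H , _) = vertex L0 c , c∈H ,
    ≤-trans (outdeg≤ H _ (below c) (above c)
                     (λ d e → cong isGT (crossingArc H L0 c L0 d refl e))
                     (λ d e → contradiction e (absent H (none₁ d)))
                     (λ d → absent H (none₂ d)))
            (≤-reflexive (count-below+count-above c))
  ...     | inj₂ none₀ with vertex-surjective w
  ...       | L0 , c , refl with () ← trans (sym w∈H) (none₀ c)
  ...       | L1 , c , refl with () ← trans (sym w∈H) (none₁ c)
  ...       | L2 , c , refl with () ← trans (sym w∈H) (none₂ c)

proposition19 : ∀ (k : ℕ) → 1 ≤ k →
    ∃ λ (n : ℕ) → ∃ λ (G : Digraph n) →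
    Oriented G × OutDegenerate k G × ¬ Mixing (suc k) G
proposition19 (suc k) _ = n , G , oriented , outDegenerate ,
  frozen⇒¬mixing (byClass idₚ) (byClass (transpose zero (suc zero))) byClass-frozen
                 (λ same → 0≢1 (cong (λ colour → colour (vertex L0 zero)) same))
  where
    open Construction (suc k)
    0≢1 : zero ≢ suc zero
    0≢1 ()
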